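{- If $G$ is a finite simple graph with $n$ vertices, then $\theta(G)\leq 2\sqrt{n\cdot \mathrm{im}(G)}$.
   Context: For a finite simple graph $G$, $\mathrm{Ind}(G)$ is the simplicial complex of independent sets of $G$ and $\theta(G):=\theta(\mathrm{Ind}(G))$. Equivalently, $\theta(G)=0$ if $G$ has no edges, and otherwise $\theta(G)=\min_{v}\max\{\theta(G-v),\ \theta(G-N_G[v])+1\}$, the minimum taken over non-isolated vertices $v$ of $G$, where $N_G[v]$ is the closed neighborhood of $v$. (For a general simplicial complex $X$: with $\mathrm{del}(X;v)=\{S\in X:v\notin S\}$, $\mathrm{lk}(X;v)=\{T\in X:v\notin T, T\cup\{v\}\in X\}$, $\theta(X)=0$ if every vertex satisfies $\mathrm{lk}(X;v)=\mathrm{del}(X;v)$, and otherwise $\theta(X)=\min\max\{\theta(\mathrm{del}(X;v)),\theta(\mathrm{lk}(X;v))+1\}$ over vertices $v$ with $\mathrm{lk}(X;v)\ne\mathrm{del}(X;v)$.) An induced matching is a set $M$ of pairwise vertex-disjoint edges such that no two vertices of different edges of $M$ are adjacent; $\mathrm{im}(G)$ is the maximum size of an induced matching of $G$. -}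

module Defs where

open import Data.Nat using (ℕ; zero; suc; _+_; _⊓_; _⊔_)
open import Data.Bool using (Bool; true; false; _∧_; if_then_else_)
open import Data.Fin using (Fin)
open import Data.Fin.Properties using (_≟_)
open import Data.List using (List; []; _∷_; foldr; map; filter; allFin)
open import Data.Bool.ListAction using (any)
open import Data.List.Relation.Unary.All using (All)
open import Data.List.Relation.Unary.AllPairs using (AllPairs)
open import Data.Product using (_×_; _,_)
open import Relation.Binary.PropositionalEquality using (_≡_)
open import Relation.Nullary using (¬_; does)
open import Relation.Nullary.Decidable using (Dec)
open import Data.Bool.Properties using () renaming (_≟_ to _≟ᵇ_)

record Graph (n : ℕ) : Set where
  field
    adj    : Fin n → Fin n → Bool
    symm   : ∀ u v → adj u v ≡ adj v u
    irrefl : ∀ v → adj v v ≡ false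
open Graph public

-- Vertex subsets (used for induced subgraphs G[S]).
VSet : ℕ → Set
VSet n = Fin n → Bool

del : ∀ {n} → VSet n → Fin n → VSet n
del S v u = if does (u ≟ v) then false else S u

delN : ∀ {n} → Graph n → VSet n → Fin n → VSet n
delN G S v u = if does (u ≟ v) then false else (if adj G u v then false else S u)

nonIsolated : ∀ {n} → Graph n → VSet n → Fin n → Bool
nonIsolated {n} G S v = S v ∧ any (λ u → S u ∧ adj G v u) (allFin n)

minOr0 : List ℕ → ℕ
minOr0 []       = 0
minOr0 (x ∷ xs) = foldr _⊓_ x xs

-- θ(G[S]) computed by the recursion
--   θ(H) = 0 if H has no edges (equivalently, no non-isolated vertex),
--   θ(H) = min_{v non-isolated} max(θ(H - v), θ(H - N_H[v]) + 1) otherwise.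
-- The fuel argument bounds the recursion depth; each step removes at least one
-- vertex, so fuel n (≥ |S|) is always sufficient.
θ-fuel : ∀ {n} → ℕ → Graph n → VSet n → ℕ
θ-fuel zero    G S = 0
θ-fuel {n} (suc k) G S =
  minOr0 (map (λ v → θ-fuel k G (del S v) ⊔ suc (θ-fuel k G (delN G S v)))
              (filter (λ v → nonIsolated G S v ≟ᵇ true) (allFin n)))

θ : ∀ {n} → Graph n → ℕ
θ {n} G = θ-fuel n G (λ _ → true)

Edge : ℕ → Set
Edge n = Fin n × Fin n

farApart : ∀ {n} → Graph n → Edge n → Edge n → Set
farApart G (a , b) (c , d) =
  ¬ a ≡ c × ¬ a ≡ d × ¬ b ≡ c × ¬ b ≡ d ×
  adj G a c ≡ false × adj G a d ≡ false × adj G b c ≡ false × adj G b d ≡ false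

IsEdge : ∀ {n} → Graph n → Edge n → Set
IsEdge G (a , b) = adj G a b ≡ true

IsInducedMatching : ∀ {n} → Graph n → List (Edge n) → Set
IsInducedMatching G M = All (IsEdge G) M × AllPairs (farApart G) M

module Submission where

-- Let m be the largest size of an induced matching. We show θ(H)² ≤ 4·|S|·m for every
-- induced subgraph H = G[S], by induction. If some non-isolated v is heavy, i.e.
-- m·d² > |S| for d = |N_H[v]|, branch on v: deleting v keeps the bound, and since
-- θ(H − N_H[v]) < 2md (else its square would exceed 4m|S|), adding 1 to it costs
-- at most 4md while |S| drops by d.
-- Otherwise all non-isolated vertices have closed degree at most some X with
-- m·X² ≤ |S|. The closed neighbourhoods of the endpoints of a greedily built
-- maximal induced matching M form a vertex cover of H of size at most 2|M|X, and
-- θ never exceeds the size of a vertex cover; as |M| ≤ m, θ(H)² ≤ 4m²X² ≤ 4m|S|.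

open import Defs
open import Data.Nat using (ℕ; _*_; _≤_)
open import Data.List using (List; length)

open import Data.Bool using (Bool; true; false; _∧_; _∨_; not)
open import Data.Bool.Properties
  using (T-≡; ∧-conicalˡ; ∧-conicalʳ; ∧-identityʳ; ∧-distribˡ-∨) renaming (_≟_ to _≟ᵇ_)
open import Data.Empty using (⊥-elim)
open import Data.Fin using (Fin; zero; suc)
open import Data.Fin.Properties using (_≟_; any?)
open import Data.List using ([]; _∷_; map; allFin)
open import Data.List.Extrema.Nat using (max; xs≤max; argmax-all)
open import Data.List.Membership.Propositional using (_∈_; lose)
open import Data.List.Membership.Propositional.Properties using (∈-allFin; ∈-map⁺; ∈-filter⁺)
open import Data.List.Properties using (foldr-preservesᵒ; filter-none; length-map)
open import Data.List.Relation.Unary.All as All using (All; []; _∷_)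
open import Data.List.Relation.Unary.All.Properties using (map⁺)
open import Data.List.Relation.Unary.AllPairs using ([]; _∷_)
open import Data.List.Relation.Unary.Any using (satisfied; toSum)
open import Data.List.Relation.Unary.Any.Properties using (any⁺; any⁻)
open import Data.Nat using (zero; suc; NonZero; >-nonZero; _+_; _⊓_; _⊔_; _<_; z≤n; s≤s; _<?_)
open import Data.Nat.Induction using (<-wellFounded)
open import Data.Nat.ListAction using (sum)
open import Data.Nat.Properties hiding (_≟_)
open import Data.Nat.Tactic.RingSolver using (solve)
open import Data.Product using (_×_; _,_; proj₁; proj₂; ∃; ∃₂)
open import Data.Sum using (_⊎_; inj₁; inj₂; [_,_]′)
open import Function using (_∘_; id; _∋_; Equivalence)
open import Induction.WellFounded using (Acc; acc)
open import Relation.Binary.PropositionalEquality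
open import Relation.Nullary using (yes; no; does; _×-dec_)
open import Relation.Nullary.Decidable using (dec-true)

open import Algebra.Properties.CommutativeMonoid.Sum +-0-commutativeMonoid
  using (sum-cong-≗; ∑-distrib-+) renaming (sum to ∑)
open Equivalence using (to; from)

sum≤length*bound : ∀ {b} xs → All (_≤ b) xs → sum xs ≤ length xs * b
sum≤length*bound []       []           = z≤n
sum≤length*bound (x ∷ xs) (x≤b ∷ xs≤b) = +-mono-≤ x≤b (sum≤length*bound xs xs≤b)

square-mono : ∀ {a b} → a ≤ b → a * a ≤ b * b
square-mono a≤b = *-mono-≤ a≤b a≤b

square-⊔ : ∀ {t a b B} → t ≤ a ⊔ b → a * a ≤ B → b * b ≤ B → t * t ≤ B
square-⊔ {t} {a} {b} {B} t≤a⊔b a²≤B b²≤B = begin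
  t * t             ≤⟨ square-mono t≤a⊔b ⟩
  (a ⊔ b) * (a ⊔ b) ≡⟨ mono-≤-distrib-⊔ square-mono a b ⟩
  a * a ⊔ b * b     ≤⟨ ⊔-lub a²≤B b²≤B ⟩
  B                 ∎
  where open ≤-Reasoning

square-cancel-< : ∀ {a b} → a * a < b * b → a < b
square-cancel-< a²<b² = ≰⇒> λ b≤a → <⇒≱ a²<b² (square-mono b≤a)

square-suc≤ : ∀ {t c d N m} → t * t ≤ 4 * (c * m) → c + d ≤ N → N < m * (d * d) →
              suc t * suc t ≤ 4 * (N * m)
square-suc≤ {t} {c} {d} {N} {m} t²≤4cm c+d≤N N<md² = begin
  -- `List ℕ ∋` selects the list constructors, overloaded with those of All and AllPairs.
  suc t * suc t                         ≡⟨ solve (List ℕ ∋ t ∷ []) ⟩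
  t * t + (t + suc t)                   ≤⟨ +-mono-≤ t²≤4cm (+-mono-≤ (<⇒≤ t<2md) t<2md) ⟩
  4 * (c * m) + (2 * m * d + 2 * m * d) ≡⟨ solve (List ℕ ∋ c ∷ d ∷ m ∷ []) ⟩
  4 * ((c + d) * m)                     ≤⟨ *-monoʳ-≤ 4 (*-monoˡ-≤ m c+d≤N) ⟩
  4 * (N * m)                           ∎
  where
  open ≤-Reasoning
  m≢0 : NonZero m
  m≢0 = m*n≢0⇒m≢0 m {{>-nonZero (≤-<-trans z≤n N<md²)}}
  t<2md : t < 2 * m * d
  t<2md = square-cancel-< (begin-strict
    t * t                     ≤⟨ t²≤4cm ⟩
    4 * (c * m)               ≤⟨ *-monoʳ-≤ 4 (*-monoˡ-≤ m (≤-trans (m≤m+n c d) c+d≤N)) ⟩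
    4 * (N * m)               <⟨ *-monoʳ-< 4 (*-monoˡ-< m {{m≢0}} N<md²) ⟩
    4 * (m * (d * d) * m)     ≡⟨ solve (List ℕ ∋ d ∷ m ∷ []) ⟩
    (2 * m * d) * (2 * m * d) ∎)

square≤ : ∀ {t L X m N} → t ≤ 2 * L * X → L ≤ m → m * (X * X) ≤ N → t * t ≤ 4 * (N * m)
square≤ {t} {L} {X} {m} {N} t≤2LX L≤m mX²≤N = begin
  t * t                           ≤⟨ square-mono t≤2LX ⟩
  (2 * L * X) * (2 * L * X)       ≡⟨ solve (List ℕ ∋ L ∷ X ∷ []) ⟩
  4 * (L * (L * (X * X)))
    ≤⟨ *-monoʳ-≤ 4 (*-mono-≤ L≤m (≤-trans (*-monoˡ-≤ (X * X) L≤m) mX²≤N)) ⟩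
  4 * (m * N)                     ≡⟨ cong (4 *_) (*-comm m N) ⟩
  4 * (N * m)                     ∎
  where open ≤-Reasoning

minOr0-≤ : ∀ {x xs} → x ∈ xs → minOr0 xs ≤ x
minOr0-≤ {x} {y ∷ ys} x∈xs = foldr-preservesᵒ ⊓-≤ y ys (toSum (lose x∈xs ≤-refl))
  where
  ⊓-≤ : ∀ a b → a ≤ x ⊎ b ≤ x → a ⊓ b ≤ x
  ⊓-≤ a b = [ ≤-trans (m⊓n≤m a b) , ≤-trans (m⊓n≤n a b) ]′

toℕ : Bool → ℕ
toℕ false = 0
toℕ true  = 1

toℕ≤1 : ∀ b → toℕ b ≤ 1
toℕ≤1 false = z≤n
toℕ≤1 true  = ≤-refl

toℕ-mono : ∀ {a b} → (a ≡ true → b ≡ true) → toℕ a ≤ toℕ b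
toℕ-mono {false} _ = z≤n
toℕ-mono {true}  a⇒b rewrite a⇒b refl = ≤-refl

toℕ-∨ : ∀ a b → toℕ (a ∨ b) ≤ toℕ a + toℕ b
toℕ-∨ false b = ≤-refl
toℕ-∨ true  b = s≤s z≤n

toℕ-∖+∩ : ∀ a b → toℕ (a ∧ not b) + toℕ (a ∧ b) ≡ toℕ a
toℕ-∖+∩ false b     = refl
toℕ-∖+∩ true  false = refl
toℕ-∖+∩ true  true  = refl

∧-true : ∀ {a b} → a ∧ b ≡ true → a ≡ true × b ≡ true
∧-true {a} {b} a∧b = ∧-conicalˡ a b a∧b , ∧-conicalʳ a b a∧b

module _ {n : ℕ} where

  infixr 7 _∩_
  infixr 6 _∪_
  infixl 6 _∖_
  infix  4 _⊆_

  ∅ : VSet n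
  ∅ _ = false

  _∩_ _∪_ _∖_ : VSet n → VSet n → VSet n
  (S ∩ T) u = S u ∧ T u
  (S ∪ T) u = S u ∨ T u
  (S ∖ T) u = S u ∧ not (T u)

  _⊆_ : VSet n → VSet n → Set
  S ⊆ T = ∀ u → S u ≡ true → T u ≡ true

  ⊆-trans : ∀ {R S T} → R ⊆ S → S ⊆ T → R ⊆ T
  ⊆-trans R⊆S S⊆T u = S⊆T u ∘ R⊆S u

  ∩-monoˡ : ∀ {S T C} → S ⊆ T → S ∩ C ⊆ T ∩ C
  ∩-monoˡ S⊆T u S∩Cu = let Su , Cu = ∧-true S∩Cu in cong₂ _∧_ (S⊆T u Su) Cu

  ∖-⊆ : ∀ S T → S ∖ T ⊆ S
  ∖-⊆ S T u = proj₁ ∘ ∧-true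

  ∖⁻ : ∀ {S T u} → (S ∖ T) u ≡ true → S u ≡ true × T u ≡ false
  ∖⁻ {S} {T} {u} h with S u | T u
  ... | true | false = refl , refl

  ∖⁺ : ∀ {S T u} → S u ≡ true → T u ≡ false → (S ∖ T) u ≡ true
  ∖⁺ Su Tu rewrite Su | Tu = refl

  ∖-removes : ∀ {S T u} → T u ≡ true → (S ∖ T) u ≡ false
  ∖-removes {S} {T} {u} Tu with S u
  ... | false = refl
  ... | true  = cong not Tu

∑-mono : ∀ {n} {f g : Fin n → ℕ} → (∀ i → f i ≤ g i) → ∑ f ≤ ∑ g
∑-mono {zero}  f≤g = z≤n
∑-mono {suc n} f≤g = +-mono-≤ (f≤g zero) (∑-mono (f≤g ∘ suc))

count : ∀ {n} → VSet n → ℕ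
count S = ∑ (toℕ ∘ S)

count≤n : ∀ {n} (S : VSet n) → count S ≤ n
count≤n {zero}  S = z≤n
count≤n {suc n} S = +-mono-≤ (toℕ≤1 (S zero)) (count≤n (S ∘ suc))

count-∅ : ∀ {n} → count {n} ∅ ≡ 0
count-∅ {zero}  = refl
count-∅ {suc n} = count-∅ {n}

count-mono : ∀ {n} {S T : VSet n} → S ⊆ T → count S ≤ count T
count-mono S⊆T = ∑-mono (toℕ-mono ∘ S⊆T)

count-< : ∀ {n} {S T : VSet n} {v} → S ⊆ T → T v ≡ true → S v ≡ false → count S < count T
count-< {suc n} {S} {T} {zero} S⊆T Tv Sv rewrite Tv | Sv = s≤s (count-mono (S⊆T ∘ suc))
count-< {suc n} {S} {T} {suc v} S⊆T Tv Sv =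
  +-mono-≤-< (toℕ-mono (S⊆T zero)) (count-< (S⊆T ∘ suc) Tv Sv)

count-∪ : ∀ {n} (S T : VSet n) → count (S ∪ T) ≤ count S + count T
count-∪ S T =
  ≤-trans (∑-mono λ u → toℕ-∨ (S u) (T u)) (≤-reflexive (∑-distrib-+ (toℕ ∘ S) (toℕ ∘ T)))

count-∖+∩ : ∀ {n} (S T : VSet n) → count (S ∖ T) + count (S ∩ T) ≡ count S
count-∖+∩ S T = trans (sym (∑-distrib-+ (toℕ ∘ (S ∖ T)) (toℕ ∘ (S ∩ T))))
                      (sum-cong-≗ λ u → toℕ-∖+∩ (S u) (T u))

endpoints : ∀ {n} → List (Edge n) → List (Fin n)
endpoints []            = []
endpoints ((a , b) ∷ M) = a ∷ b ∷ endpoints M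

length-endpoints : ∀ {n} (M : List (Edge n)) → length (endpoints M) ≡ 2 * length M
length-endpoints []      = refl
length-endpoints (_ ∷ M) =
  trans (cong (2 +_) (length-endpoints M)) (sym (*-distribˡ-+ 2 1 (length M)))

module _ {n : ℕ} (G : Graph n) where

  adj-sym : ∀ {u v} → adj G u v ≡ true → adj G v u ≡ true
  adj-sym {u} {v} = trans (symm G v u)

  N[_] : Fin n → VSet n
  N[ v ] u = does (u ≟ v) ∨ adj G u v

  ⋃N[_] : List (Fin n) → VSet n
  ⋃N[ [] ]     = ∅
  ⋃N[ v ∷ vs ] = N[ v ] ∪ ⋃N[ vs ]

  closedDegree : VSet n → Fin n → ℕ
  closedDegree S v = count (S ∩ N[ v ])

  v∈N[v] : ∀ v → N[ v ] v ≡ true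
  v∈N[v] v = cong (_∨ adj G v v) (dec-true (v ≟ v) refl)

  ∉N[_] : ∀ v {u} → N[ v ] u ≡ false → v ≢ u × adj G v u ≡ false
  ∉N[ v ] {u} u∉N[v] with u ≟ v
  ∉N[ v ] {u} () | yes _
  ... | no u≢v = u≢v ∘ sym , trans (symm G v u) u∉N[v]

  del⊆ : ∀ (S : VSet n) v → del S v ⊆ S
  del⊆ S v u h with does (u ≟ v)
  ... | false = h

  del-self : ∀ (S : VSet n) v → del S v v ≡ false
  del-self S v rewrite dec-true (v ≟ v) refl = refl

  delN⊆del : ∀ (S : VSet n) v → delN G S v ⊆ del S v
  delN⊆del S v u h with does (u ≟ v) | adj G u v
  ... | false | false = h

  delN⊆∖N : ∀ (S : VSet n) v → delN G S v ⊆ S ∖ N[ v ]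
  delN⊆∖N S v u h with does (u ≟ v) | adj G u v
  ... | false | false = trans (∧-identityʳ (S u)) h

  count-delN+closedDegree : ∀ (S : VSet n) v → count (delN G S v) + closedDegree S v ≤ count S
  count-delN+closedDegree S v = begin
    count (delN G S v) + closedDegree S v       ≤⟨ +-monoˡ-≤ _ (count-mono (delN⊆∖N S v)) ⟩
    count (S ∖ N[ v ]) + count (S ∩ N[ v ])    ≡⟨ count-∖+∩ S N[ v ] ⟩
    count S                                     ∎
    where open ≤-Reasoning

  count-∩⋃N : ∀ (S : VSet n) vs → count (S ∩ ⋃N[ vs ]) ≤ sum (map (closedDegree S) vs)
  count-∩⋃N S []       =
    ≤-trans (count-mono {S = S ∩ ∅} {T = ∅} (λ u → proj₂ ∘ ∧-true)) (≤-reflexive (count-∅ {n}))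
  count-∩⋃N S (v ∷ vs) = begin
    count (S ∩ (N[ v ] ∪ ⋃N[ vs ]))
      ≤⟨ count-mono (λ u → trans (sym (∧-distribˡ-∨ (S u) _ _))) ⟩
    count (S ∩ N[ v ] ∪ S ∩ ⋃N[ vs ])
      ≤⟨ count-∪ (S ∩ N[ v ]) (S ∩ ⋃N[ vs ]) ⟩
    closedDegree S v + count (S ∩ ⋃N[ vs ])
      ≤⟨ +-monoʳ-≤ _ (count-∩⋃N S vs) ⟩
    closedDegree S v + sum (map (closedDegree S) vs) ∎
    where open ≤-Reasoning

  nonIsolated⁺ : ∀ {S u v} → S v ≡ true → S u ≡ true → adj G v u ≡ true →
                 nonIsolated G S v ≡ true
  nonIsolated⁺ {S} {u} {v} Sv Su vu rewrite Sv =
    to T-≡ (any⁺ _ (lose (∈-allFin u) (from T-≡ (cong₂ _∧_ Su vu))))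

  nonIsolated⁻ : ∀ {S v} → nonIsolated G S v ≡ true →
                 ∃ λ u → S v ≡ true × S u ≡ true × adj G v u ≡ true
  nonIsolated⁻ {S} {v} h with S v
  ... | true = let u , Su∧vu = satisfied (any⁻ _ (allFin n) (from T-≡ h))
                   Su , vu = ∧-true (to T-≡ Su∧vu)
               in u , refl , Su , vu

  Edgeless : VSet n → Set
  Edgeless S = ∀ v → nonIsolated G S v ≢ true

  edge-or-edgeless : ∀ S → (∃₂ λ u v → S u ≡ true × S v ≡ true × adj G u v ≡ true) ⊎ Edgeless S
  edge-or-edgeless S with any? (λ v → nonIsolated G S v ≟ᵇ true)
  ... | yes (v , nv) = inj₁ (v , nonIsolated⁻ nv)
  ... | no noEdge    = inj₂ λ v nv → noEdge (v , nv)

  θ-edgeless : ∀ k {S} → Edgeless S → θ-fuel (suc k) G S ≡ 0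
  θ-edgeless k {S} edgeless =
    cong (minOr0 ∘ map _)
      (filter-none (λ v → nonIsolated G S v ≟ᵇ true) {allFin n} (All.tabulate λ {v} _ → edgeless v))

  θ-branch : ∀ k {S v} → nonIsolated G S v ≡ true →
             θ-fuel (suc k) G S ≤ θ-fuel k G (del S v) ⊔ suc (θ-fuel k G (delN G S v))
  θ-branch k {S} {v} nv =
    minOr0-≤ (∈-map⁺ _ (∈-filter⁺ (λ w → nonIsolated G S w ≟ᵇ true) (∈-allFin v) nv))

  VertexCover : VSet n → VSet n → Set
  VertexCover S C =
    ∀ {u w} → S u ≡ true → S w ≡ true → adj G u w ≡ true → C u ≡ true ⊎ C w ≡ true

  cover-antitone : ∀ {S′ S C} → S′ ⊆ S → VertexCover S C → VertexCover S′ C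
  cover-antitone S′⊆S cover Su Sw = cover (S′⊆S _ Su) (S′⊆S _ Sw)

  cover-extend : ∀ {S X C} → VertexCover (S ∖ X) C → VertexCover S (X ∪ C)
  cover-extend {S} {X} cover {u} {w} Su Sw uw with X u in Xu | X w in Xw
  ... | true  | _     = inj₁ refl
  ... | false | true  = inj₂ refl
  ... | false | false = cover (∖⁺ {S = S} {T = X} Su Xu) (∖⁺ {S = S} {T = X} Sw Xw) uw

  θ-fuel≤cover : ∀ k {S C} → VertexCover S C → θ-fuel k G S ≤ count (S ∩ C)
  θ-fuel≤cover zero    _ = z≤n
  θ-fuel≤cover (suc k) {S} {C} cover with edge-or-edgeless S
  ... | inj₂ edgeless = ≤-trans (≤-reflexive (θ-edgeless k edgeless)) z≤n
  ... | inj₁ (u , w , Su , Sw , uw) =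
    [ branchAt (nonIsolated⁺ Su Sw uw) Su , branchAt (nonIsolated⁺ Sw Su (adj-sym uw)) Sw ]′
      (cover Su Sw uw)
    where
    -- Both branches at a covered endpoint v lose the vertex v of S ∩ C.
    branchAt : ∀ {v} → nonIsolated G S v ≡ true → S v ≡ true → C v ≡ true →
               θ-fuel (suc k) G S ≤ count (S ∩ C)
    branchAt {v} nv Sv Cv =
      ≤-trans (θ-branch k nv) (⊔-lub (<⇒≤ (≤-<-trans del-bound shrink)) (≤-<-trans delN-bound shrink))
      where
      shrink : count (del S v ∩ C) < count (S ∩ C)
      shrink = count-< (∩-monoˡ (del⊆ S v)) (cong₂ _∧_ Sv Cv) (cong (_∧ C v) (del-self S v))
      del-bound : θ-fuel k G (del S v) ≤ count (del S v ∩ C)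
      del-bound = θ-fuel≤cover k (cover-antitone (del⊆ S v) cover)
      delN-bound : θ-fuel k G (delN G S v) ≤ count (del S v ∩ C)
      delN-bound = ≤-trans (θ-fuel≤cover k (cover-antitone (⊆-trans (delN⊆del S v) (del⊆ S v)) cover))
                           (count-mono (∩-monoˡ (delN⊆del S v)))

  EdgeIn : VSet n → Edge n → Set
  EdgeIn S (a , b) = S a ≡ true × S b ≡ true

  record CoveringInducedMatching (S : VSet n) : Set where
    field
      matching : List (Edge n)
      induced  : IsInducedMatching G matching
      inside   : All (EdgeIn S) matching
      covering : VertexCover S ⋃N[ endpoints matching ]

  coveringInducedMatching : ∀ S → Acc _<_ (count S) → CoveringInducedMatching S
  coveringInducedMatching S (acc smaller) with edge-or-edgeless S
  ... | inj₂ edgeless = record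
    { matching = []
    ; induced  = [] , []
    ; inside   = []
    ; covering = λ Su Sw uw → ⊥-elim (edgeless _ (nonIsolated⁺ Su Sw uw))
    }
  ... | inj₁ (a , b , Sa , Sb , ab) = record
    { matching = (a , b) ∷ Rest.matching
    ; induced  = ab ∷ proj₁ Rest.induced , All.map farFrom Rest.inside ∷ proj₂ Rest.induced
    ; inside   = (Sa , Sb) ∷ All.map (λ {e} → within e) Rest.inside
    ; covering = cover-extend {S} (cover-extend {S ∖ N[ a ]} Rest.covering)
    }
    where
    S′ : VSet n
    S′ = S ∖ N[ a ] ∖ N[ b ]
    S′⊆S : S′ ⊆ S
    S′⊆S = ⊆-trans (∖-⊆ _ _) (∖-⊆ _ _)
    S′<S : count S′ < count S
    S′<S = count-< S′⊆S Sa (cong (_∧ _) (∖-removes {S = S} {T = N[ a ]} (v∈N[v] a)))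
    module Rest = CoveringInducedMatching (coveringInducedMatching S′ (smaller S′<S))
    within : ∀ e → EdgeIn S′ e → EdgeIn S e
    within (c , d) (S′c , S′d) = S′⊆S c S′c , S′⊆S d S′d
    apart : ∀ {x} → S′ x ≡ true → (a ≢ x × adj G a x ≡ false) × (b ≢ x × adj G b x ≡ false)
    apart S′x = let S∖Nax , x∉Nb = ∖⁻ {S = S ∖ N[ a ]} {T = N[ b ]} S′x
                    _ , x∉Na = ∖⁻ {S = S} {T = N[ a ]} S∖Nax
                in ∉N[ a ] x∉Na , ∉N[ b ] x∉Nb
    farFrom : ∀ {e} → EdgeIn S′ e → farApart G (a , b) e
    farFrom {c , d} (S′c , S′d) =
      let (a≢c , ac) , (b≢c , bc) = apart S′c
          (a≢d , ad) , (b≢d , bd) = apart S′d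
      in a≢c , a≢d , b≢c , b≢d , ac , ad , bc , bd

  endpoints-nonIsolated : ∀ {S M} → All (IsEdge G) M → All (EdgeIn S) M →
                          All (λ v → nonIsolated G S v ≡ true) (endpoints M)
  endpoints-nonIsolated {M = []}          []        []              = []
  endpoints-nonIsolated {M = (a , b) ∷ M} (ab ∷ es) ((Sa , Sb) ∷ ss) =
    nonIsolated⁺ Sa Sb ab ∷ nonIsolated⁺ Sb Sa (adj-sym ab) ∷ endpoints-nonIsolated es ss

  module _ (m : ℕ) (maximum : ∀ M → IsInducedMatching G M → length M ≤ m) where

    θ-fuel²-light : ∀ k S →
      (∀ v → nonIsolated G S v ≡ true → m * (closedDegree S v * closedDegree S v) ≤ count S) →
      θ-fuel k G S * θ-fuel k G S ≤ 4 * (count S * m)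
    θ-fuel²-light k S light = square≤ θ≤2LX (maximum matching induced) mX²≤N
      where
      open CoveringInducedMatching (coveringInducedMatching S (<-wellFounded (count S)))
      degrees : List ℕ
      degrees = map (closedDegree S) (endpoints matching)
      X : ℕ
      X = max 0 degrees
      θ≤2LX : θ-fuel k G S ≤ 2 * length matching * X
      θ≤2LX = begin
        θ-fuel k G S                          ≤⟨ θ-fuel≤cover k covering ⟩
        count (S ∩ ⋃N[ endpoints matching ])  ≤⟨ count-∩⋃N S (endpoints matching) ⟩
        sum degrees                           ≤⟨ sum≤length*bound degrees (xs≤max 0 degrees) ⟩
        length degrees * X
          ≡⟨ cong (_* X) (trans (length-map _ (endpoints matching)) (length-endpoints matching)) ⟩
        2 * length matching * X               ∎
        where open ≤-Reasoning
      mX²≤N : m * (X * X) ≤ count S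
      mX²≤N = argmax-all id {P = λ d → m * (d * d) ≤ count S}
                (≤-trans (≤-reflexive (*-zeroʳ m)) z≤n)
                (map⁺ (All.map (λ {v} → light v) (endpoints-nonIsolated (proj₁ induced) inside)))

    θ-fuel²-bound : ∀ k S → θ-fuel k G S * θ-fuel k G S ≤ 4 * (count S * m)
    θ-fuel²-bound zero    S = z≤n
    θ-fuel²-bound (suc k) S
      with any? (λ v → (nonIsolated G S v ≟ᵇ true)
                  ×-dec (count S <? m * (closedDegree S v * closedDegree S v)))
    ... | yes (v , nv , heavy) = square-⊔ (θ-branch k nv) del² delN²
      where
      del² : θ-fuel k G (del S v) * θ-fuel k G (del S v) ≤ 4 * (count S * m)
      del² = ≤-trans (θ-fuel²-bound k (del S v)) (*-monoʳ-≤ 4 (*-monoˡ-≤ m (count-mono (del⊆ S v))))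
      delN² : suc (θ-fuel k G (delN G S v)) * suc (θ-fuel k G (delN G S v)) ≤ 4 * (count S * m)
      delN² = square-suc≤ {θ-fuel k G (delN G S v)} {count (delN G S v)} {closedDegree S v}
                (θ-fuel²-bound k (delN G S v)) (count-delN+closedDegree S v) heavy
    ... | no noHeavy = θ-fuel²-light (suc k) S λ v nv → ≮⇒≥ λ heavy → noHeavy (v , nv , heavy)

theorem41 : ∀ (n : ℕ) (G : Graph n) (M : List (Edge n)) →
    IsInducedMatching G M →
    (∀ (M′ : List (Edge n)) → IsInducedMatching G M′ → length M′ ≤ length M) →
    θ G * θ G ≤ 4 * (n * length M)
theorem41 n G M _ maximum = begin
  θ G * θ G                                ≤⟨ θ-fuel²-bound G (length M) maximum n (λ _ → true) ⟩
  4 * (count {n} (λ _ → true) * length M)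
    ≤⟨ *-monoʳ-≤ 4 (*-monoˡ-≤ (length M) (count≤n {n} (λ _ → true))) ⟩
  4 * (n * length M)                       ∎
  where open ≤-Reasoning
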